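{- (1) For every graph $G$ with $n$ vertices, $\mu(G)\le \frac{2}{3}(n-2)e(G)$. (2) Let $r\ge 1$, let $G$ be a graph with $\Delta(G)\le r$, and let $T$ be a cluster of $G$ with $t=|T|$ and $s=|S|$ satisfying $t\ge \frac{2}{3}(s-2)$. Then $T$ is foldable.
   Context: For a graph $H$, $\mu(H)=2\#(H,K_3)+\#(H,P_3)$, where $\#(H,K_3)$ and $\#(H,P_3)$ count 3-subsets of $V(H)$ inducing a triangle, respectively a path with two edges; $e(H)$ is the number of edges. For an edge $xy$ of $G$, $w(xy)=|N(x)\cap N(y)|$; an edge is tight if $w(xy)=r-1$; a tight clique is a clique all of whose edges are tight; a cluster is a maximal tight clique with at least two vertices. For a cluster $T$, $S=\bigcap_{x\in T}N(x)$ and $R$ is the graph on $S$ whose edges are the pairs of $S$ non-adjacent in $G$. $T$ is foldable if $t\cdot e(R)\ge \mu(R)$. -}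

module Defs where

open import Data.Nat using (ℕ; zero; suc; _+_; _*_; _∸_; _≤_; _<ᵇ_; _≡ᵇ_)
open import Data.Bool using (Bool; true; false; if_then_else_; _∧_; _∨_; not)
open import Data.Fin using (Fin; toℕ) renaming (zero to fzero; suc to fsuc)
open import Data.Fin.Subset using (Subset; _∈_; _⊆_; ∣_∣)
open import Data.Vec using (lookup; tabulate)
open import Data.Product using (_×_)
open import Relation.Binary.PropositionalEquality using (_≡_; _≢_)

record Graph (n : ℕ) : Set where
  field
    adj    : Fin n → Fin n → Bool
    sym    : ∀ i j → adj i j ≡ adj j i
    irrefl : ∀ i → adj i i ≡ false
open Graph public

sumF : ∀ {n} → (Fin n → ℕ) → ℕ
sumF {zero}  f = 0
sumF {suc n} f = f fzero + sumF (λ i → f (fsuc i))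

𝟙 : Bool → ℕ
𝟙 b = if b then 1 else 0

count : ∀ {n} → (Fin n → Bool) → ℕ
count f = sumF (λ i → 𝟙 (f i))

allF : ∀ {n} → (Fin n → Bool) → Bool
allF {zero}  f = true
allF {suc n} f = f fzero ∧ allF (λ i → f (fsuc i))

_<F_ : ∀ {n} → Fin n → Fin n → Bool
i <F j = toℕ i <ᵇ toℕ j

-- a "graph on vertex set S" is given by an adjacency function restricted to S ⊆ Fin n.
-- Number of edges of the graph (adjacency a) induced on S.
eOn : ∀ {n} → (Fin n → Fin n → Bool) → Subset n → ℕ
eOn a S = sumF λ i → sumF λ j →
  𝟙 ((i <F j) ∧ lookup S i ∧ lookup S j ∧ a i j)

edges3 : ∀ {n} → (Fin n → Fin n → Bool) → Fin n → Fin n → Fin n → ℕ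
edges3 a x y z = 𝟙 (a x y) + 𝟙 (a x z) + 𝟙 (a y z)

#K3On : ∀ {n} → (Fin n → Fin n → Bool) → Subset n → ℕ
#K3On a S = sumF λ i → sumF λ j → sumF λ k →
  𝟙 ((i <F j) ∧ (j <F k) ∧ lookup S i ∧ lookup S j ∧ lookup S k
     ∧ (edges3 a i j k ≡ᵇ 3))

#P3On : ∀ {n} → (Fin n → Fin n → Bool) → Subset n → ℕ
#P3On a S = sumF λ i → sumF λ j → sumF λ k →
  𝟙 ((i <F j) ∧ (j <F k) ∧ lookup S i ∧ lookup S j ∧ lookup S k
     ∧ (edges3 a i j k ≡ᵇ 2))

μOn : ∀ {n} → (Fin n → Fin n → Bool) → Subset n → ℕ
μOn a S = 2 * #K3On a S + #P3On a S

allV : ∀ {n} → Subset n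
allV = tabulate (λ _ → true)

e : ∀ {n} → Graph n → ℕ
e G = eOn (adj G) allV

μ : ∀ {n} → Graph n → ℕ
μ G = μOn (adj G) allV

deg : ∀ {n} → Graph n → Fin n → ℕ
deg G v = count (adj G v)

MaxDeg≤ : ∀ {n} → Graph n → ℕ → Set
MaxDeg≤ G r = ∀ v → deg G v ≤ r

w : ∀ {n} → Graph n → Fin n → Fin n → ℕ
w G x y = count (λ u → adj G x u ∧ adj G y u)

Tight : ∀ {n} → Graph n → ℕ → Fin n → Fin n → Set
Tight G r x y = (adj G x y ≡ true) × (w G x y ≡ r ∸ 1)

TightClique : ∀ {n} → Graph n → ℕ → Subset n → Set
TightClique G r T = ∀ x y → x ∈ T → y ∈ T → x ≢ y → Tight G r x y

Cluster : ∀ {n} → Graph n → ℕ → Subset n → Set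
Cluster G r T =
  TightClique G r T × (2 ≤ ∣ T ∣) × (∀ T′ → TightClique G r T′ → T ⊆ T′ → T′ ⊆ T)

-- S = ⋂_{x ∈ T} N(x)
commonNbhd : ∀ {n} → Graph n → Subset n → Subset n
commonNbhd G T = tabulate λ v → allF λ x → not (lookup T x) ∨ adj G x v

-- adjacency of the complement of G (R = complement of G restricted to S)
nonAdj : ∀ {n} → Graph n → Fin n → Fin n → Bool
nonAdj G i j = not (adj G i j) ∧ not (toℕ i ≡ᵇ toℕ j)

Foldable : ∀ {n} → Graph n → Subset n → Set
Foldable G T =
  μOn (nonAdj G) (commonNbhd G T) ≤ ∣ T ∣ * eOn (nonAdj G) (commonNbhd G T)

-- Every pair of vertices of a graph on s vertices lies in exactly s − 2 vertex
-- triples, so summing the number of edges inside each triple gives (s − 2)·e.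
-- A triple inducing a triangle contains 3 edges and one inducing P₃ contains 2,
-- hence 3μ = 6·#K₃ + 3·#P₃ ≤ 2·(3·#K₃ + 2·#P₃) ≤ 2(s − 2)·e. Part (2) is part (1)
-- for the graph R on S, combined with 2(s − 2) ≤ 3t.
module Submission where

open import Data.Bool using (Bool; true; false; _∧_)
open import Data.Fin using (Fin) renaming (zero to fzero; suc to fsuc)
open import Data.Fin.Subset using (Subset; ∣_∣)
open import Data.Nat using (ℕ; zero; suc; _+_; _*_; _∸_; _≤_; z≤n; s≤s; _≡ᵇ_)
open import Data.Nat.Properties
open import Data.Nat.Solver using (module +-*-Solver)
open import Data.Product using (_×_; _,_)
open import Data.Vec using ([]; _∷_; lookup)
open import Relation.Binary.PropositionalEquality
open import Defs hiding (sym)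

open +-*-Solver
open ≡-Reasoning

sumF-cong : ∀ {n} {f g : Fin n → ℕ} → (∀ i → f i ≡ g i) → sumF f ≡ sumF g
sumF-cong {zero}  f≡g = refl
sumF-cong {suc n} f≡g = cong₂ _+_ (f≡g fzero) (sumF-cong (λ i → f≡g (fsuc i)))

sumF-zero : ∀ {n} → sumF {n} (λ _ → 0) ≡ 0
sumF-zero {zero}  = refl
sumF-zero {suc n} = sumF-zero {n}

sumF-+ : ∀ {n} (f g : Fin n → ℕ) → sumF (λ i → f i + g i) ≡ sumF f + sumF g
sumF-+ {zero}  f g = refl
sumF-+ {suc n} f g =
  begin
    f fzero + g fzero + sumF (λ i → f (fsuc i) + g (fsuc i))
  ≡⟨ cong (f fzero + g fzero +_) (sumF-+ (λ i → f (fsuc i)) (λ i → g (fsuc i))) ⟩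
    f fzero + g fzero + (sumF (λ i → f (fsuc i)) + sumF (λ i → g (fsuc i)))
  ≡⟨ +-assoc-comm (f fzero) (g fzero) _ _ ⟩
    f fzero + sumF (λ i → f (fsuc i)) + (g fzero + sumF (λ i → g (fsuc i)))
  ∎
  where
  +-assoc-comm : ∀ a b c d → a + b + (c + d) ≡ a + c + (b + d)
  +-assoc-comm = solve 4 (λ a b c d → a :+ b :+ (c :+ d) := a :+ c :+ (b :+ d)) refl

sumF-* : ∀ {n} (c : ℕ) (f : Fin n → ℕ) → sumF (λ i → c * f i) ≡ c * sumF f
sumF-* {zero}  c f = sym (*-zeroʳ c)
sumF-* {suc n} c f =
  trans (cong (c * f fzero +_) (sumF-* c (λ i → f (fsuc i))))
        (sym (*-distribˡ-+ c (f fzero) _))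

sumF-mono : ∀ {n} {f g : Fin n → ℕ} → (∀ i → f i ≤ g i) → sumF f ≤ sumF g
sumF-mono {zero}  f≤g = z≤n
sumF-mono {suc n} f≤g = +-mono-≤ (f≤g fzero) (sumF-mono (λ i → f≤g (fsuc i)))

∣S∣≡count : ∀ {n} (S : Subset n) → ∣ S ∣ ≡ count (lookup S)
∣S∣≡count []          = refl
∣S∣≡count (true ∷ S)  = cong suc (∣S∣≡count S)
∣S∣≡count (false ∷ S) = ∣S∣≡count S

module _ {n : ℕ} where

  tripleEdgeSum : (Fin n → Fin n → Bool) → Subset n → ℕ
  tripleEdgeSum a S = sumF λ i → sumF λ j → sumF λ k →
    𝟙 ((i <F j) ∧ (j <F k) ∧ lookup S i ∧ lookup S j ∧ lookup S k) * edges3 a i j k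

  countOn : (Fin n → Bool) → Subset n → ℕ
  countOn α S = count λ j → lookup S j ∧ α j

  endpointSum : (Fin n → Bool) → Subset n → ℕ
  endpointSum α S = sumF λ j → sumF λ k →
    𝟙 ((j <F k) ∧ lookup S j ∧ lookup S k) * (𝟙 (α j) + 𝟙 (α k))

𝟙-∧-+ : ∀ p x q → 𝟙 p * (x + 𝟙 q) ≡ x * 𝟙 p + 𝟙 (p ∧ q)
𝟙-∧-+ true  x q = trans (+-identityʳ (x + 𝟙 q)) (cong (_+ 𝟙 q) (sym (*-identityʳ x)))
𝟙-∧-+ false x q = sym (trans (+-identityʳ _) (*-zeroʳ x))

𝟙-∧-* : ∀ p q r t → 𝟙 (p ∧ q ∧ r) * 𝟙 t ≡ 𝟙 (p ∧ q ∧ r ∧ t)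
𝟙-∧-* true  true  true  t = +-identityʳ (𝟙 t)
𝟙-∧-* true  true  false t = refl
𝟙-∧-* true  false r     t = refl
𝟙-∧-* false q     r     t = refl

𝟙-∧-false : ∀ p q x → 𝟙 (p ∧ false ∧ q) * x ≡ 0
𝟙-∧-false true  q x = refl
𝟙-∧-false false q x = refl

endpointSum+countOn≡∣S∣*countOn : ∀ {n} (α : Fin n → Bool) (S : Subset n) →
  endpointSum α S + countOn α S ≡ ∣ S ∣ * countOn α S
endpointSum+countOn≡∣S∣*countOn α []          = refl
endpointSum+countOn≡∣S∣*countOn {suc n} α (false ∷ S) =
  trans (cong (λ z → z + endpointSum α′ S + countOn α′ S) (sumF-zero {n}))
        (endpointSum+countOn≡∣S∣*countOn α′ S)
  where α′ = λ j → α (fsuc j)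
endpointSum+countOn≡∣S∣*countOn α (true ∷ S) =
  begin
    (sumF (λ k → 𝟙 (lookup S k) * (x + 𝟙 (α′ k))) + P) + (x + D)
  ≡⟨ cong (λ z → z + P + (x + D)) pairsThroughHead ⟩
    (x * ∣ S ∣ + D + P) + (x + D)
  ≡⟨ solve 4 (λ X C D P → (X :* C :+ D :+ P) :+ (X :+ D)
                       := (X :* C :+ X :+ D) :+ (P :+ D)) refl x ∣ S ∣ D P ⟩
    (x * ∣ S ∣ + x + D) + (P + D)
  ≡⟨ cong (x * ∣ S ∣ + x + D +_) (endpointSum+countOn≡∣S∣*countOn α′ S) ⟩
    (x * ∣ S ∣ + x + D) + ∣ S ∣ * D
  ≡⟨ solve 3 (λ X C D → (X :* C :+ X :+ D) :+ C :* D
                     := (con 1 :+ C) :* (X :+ D)) refl x ∣ S ∣ D ⟩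
    (1 + ∣ S ∣) * (x + D)
  ∎
  where
  α′ = λ j → α (fsuc j)
  x = 𝟙 (α fzero)
  P = endpointSum α′ S
  D = countOn α′ S
  pairsThroughHead : sumF (λ k → 𝟙 (lookup S k) * (x + 𝟙 (α′ k))) ≡ x * ∣ S ∣ + D
  pairsThroughHead =
    begin
      sumF (λ k → 𝟙 (lookup S k) * (x + 𝟙 (α′ k)))
    ≡⟨ sumF-cong (λ k → 𝟙-∧-+ (lookup S k) x (α′ k)) ⟩
      sumF (λ k → x * 𝟙 (lookup S k) + 𝟙 (lookup S k ∧ α′ k))
    ≡⟨ sumF-+ (λ k → x * 𝟙 (lookup S k)) (λ k → 𝟙 (lookup S k ∧ α′ k)) ⟩
      sumF (λ k → x * 𝟙 (lookup S k)) + D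
    ≡⟨ cong (_+ D) (sumF-* x (λ k → 𝟙 (lookup S k))) ⟩
      x * count (lookup S) + D
    ≡⟨ cong (λ c → x * c + D) (sym (∣S∣≡count S)) ⟩
      x * ∣ S ∣ + D
    ∎

module HeadVertex {n : ℕ} (a : Fin (suc n) → Fin (suc n) → Bool) where

  nbrs : Fin n → Bool
  nbrs j = a fzero (fsuc j)

  rest : Fin n → Fin n → Bool
  rest i j = a (fsuc i) (fsuc j)

  triplesThroughHead : Bool → Subset n → ℕ
  triplesThroughHead b S = sumF λ j → sumF λ k →
    𝟙 ((j <F k) ∧ b ∧ lookup S j ∧ lookup S k) * edges3 a fzero (fsuc j) (fsuc k)

  tripleEdgeSum-∷ : ∀ b S →
    tripleEdgeSum a (b ∷ S) ≡ triplesThroughHead b S + tripleEdgeSum rest S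
  -- Vertex 0 can only be the least element of a triple; the other placements
  -- leave an ordering guard that is false (or a sum of zeros).
  tripleEdgeSum-∷ b S =
    cong₂ _+_ (cong (_+ triplesThroughHead b S) (sumF-zero {suc n}))
      (sumF-cong {n} λ i → cong₂ _+_ (sumF-zero {suc n}) (sumF-cong {n} λ j →
        cong (_+ sumF (λ k → 𝟙 ((i <F j) ∧ (j <F k) ∧ lookup S i ∧ lookup S j ∧ lookup S k)
                             * edges3 rest i j k))
          (𝟙-∧-false (i <F j) (lookup S i ∧ lookup S j ∧ b) (edges3 a (fsuc i) (fsuc j) fzero))))

  triplesThroughHead-false : ∀ S → triplesThroughHead false S ≡ 0
  triplesThroughHead-false S =
    trans (sumF-cong λ j → trans (sumF-cong λ k →
            𝟙-∧-false (j <F k) (lookup S j ∧ lookup S k) (edges3 a fzero (fsuc j) (fsuc k)))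
          (sumF-zero {n}))
      (sumF-zero {n})

  triplesThroughHead-true : ∀ S → triplesThroughHead true S ≡ endpointSum nbrs S + eOn rest S
  triplesThroughHead-true S =
    begin
      sumF (λ j → sumF λ k → g j k * (𝟙 (nbrs j) + 𝟙 (nbrs k) + 𝟙 (rest j k)))
    ≡⟨ sumF-cong (λ j → sumF-cong λ k → *-distribˡ-+ (g j k) _ _) ⟩
      sumF (λ j → sumF λ k → g j k * (𝟙 (nbrs j) + 𝟙 (nbrs k)) + g j k * 𝟙 (rest j k))
    ≡⟨ sumF-cong (λ j → sumF-+ (λ k → g j k * (𝟙 (nbrs j) + 𝟙 (nbrs k))) _) ⟩
      sumF (λ j → sumF (λ k → g j k * (𝟙 (nbrs j) + 𝟙 (nbrs k))) + sumF λ k → g j k * 𝟙 (rest j k))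
    ≡⟨ sumF-+ (λ j → sumF λ k → g j k * (𝟙 (nbrs j) + 𝟙 (nbrs k))) _ ⟩
      endpointSum nbrs S + sumF (λ j → sumF λ k → g j k * 𝟙 (rest j k))
    ≡⟨ cong (endpointSum nbrs S +_) (sumF-cong λ j → sumF-cong λ k →
         𝟙-∧-* (j <F k) (lookup S j) (lookup S k) (rest j k)) ⟩
      endpointSum nbrs S + eOn rest S
    ∎
    where
    g : Fin n → Fin n → ℕ
    g j k = 𝟙 ((j <F k) ∧ lookup S j ∧ lookup S k)

tripleEdgeSum+2e≡∣S∣*e : ∀ {n} (a : Fin n → Fin n → Bool) (S : Subset n) →
  tripleEdgeSum a S + 2 * eOn a S ≡ ∣ S ∣ * eOn a S
tripleEdgeSum+2e≡∣S∣*e a [] = refl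
tripleEdgeSum+2e≡∣S∣*e {suc n} a (false ∷ S) =
  begin
    tripleEdgeSum a (false ∷ S) + 2 * eOn a (false ∷ S)
  ≡⟨ cong₂ (λ t e → t + 2 * e) (tripleEdgeSum-∷ false S) eOn-false ⟩
    triplesThroughHead false S + tripleEdgeSum rest S + 2 * eOn rest S
  ≡⟨ cong (λ z → z + tripleEdgeSum rest S + 2 * eOn rest S) (triplesThroughHead-false S) ⟩
    tripleEdgeSum rest S + 2 * eOn rest S
  ≡⟨ tripleEdgeSum+2e≡∣S∣*e rest S ⟩
    ∣ S ∣ * eOn rest S
  ≡⟨ cong (∣ S ∣ *_) (sym eOn-false) ⟩
    ∣ S ∣ * eOn a (false ∷ S)
  ∎
  where
  open HeadVertex a
  eOn-false : eOn a (false ∷ S) ≡ eOn rest S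
  eOn-false = cong (_+ eOn rest S) (sumF-zero {n})
tripleEdgeSum+2e≡∣S∣*e {suc n} a (true ∷ S) =
  begin
    tripleEdgeSum a (true ∷ S) + 2 * (D + E)
  ≡⟨ cong (_+ 2 * (D + E)) (tripleEdgeSum-∷ true S) ⟩
    triplesThroughHead true S + T + 2 * (D + E)
  ≡⟨ cong (λ z → z + T + 2 * (D + E)) (triplesThroughHead-true S) ⟩
    P + E + T + 2 * (D + E)
  ≡⟨ solve 4 (λ P E T D → P :+ E :+ T :+ con 2 :* (D :+ E)
                       := (T :+ con 2 :* E) :+ (P :+ D) :+ D :+ E) refl P E T D ⟩
    (T + 2 * E) + (P + D) + D + E
  ≡⟨ cong₂ (λ u v → u + v + D + E) (tripleEdgeSum+2e≡∣S∣*e rest S)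
                                   (endpointSum+countOn≡∣S∣*countOn nbrs S) ⟩
    ∣ S ∣ * E + ∣ S ∣ * D + D + E
  ≡⟨ solve 3 (λ C E D → C :* E :+ C :* D :+ D :+ E := (con 1 :+ C) :* (D :+ E)) refl ∣ S ∣ E D ⟩
    (1 + ∣ S ∣) * (D + E)
  ∎
  where
  open HeadVertex a
  P = endpointSum nbrs S
  D = countOn nbrs S
  E = eOn rest S
  T = tripleEdgeSum rest S

tripleEdgeSum≡[∣S∣∸2]*e : ∀ {n} (a : Fin n → Fin n → Bool) (S : Subset n) →
  tripleEdgeSum a S ≡ (∣ S ∣ ∸ 2) * eOn a S
tripleEdgeSum≡[∣S∣∸2]*e a S =
  begin
    tripleEdgeSum a S
  ≡⟨ sym (m+n∸n≡m (tripleEdgeSum a S) (2 * eOn a S)) ⟩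
    tripleEdgeSum a S + 2 * eOn a S ∸ 2 * eOn a S
  ≡⟨ cong (_∸ 2 * eOn a S) (tripleEdgeSum+2e≡∣S∣*e a S) ⟩
    ∣ S ∣ * eOn a S ∸ 2 * eOn a S
  ≡⟨ sym (*-distribʳ-∸ (eOn a S) ∣ S ∣ 2) ⟩
    (∣ S ∣ ∸ 2) * eOn a S
  ∎

μ≤⅔ : ℕ → ℕ → ℕ → Set
μ≤⅔ k p m = 3 * (2 * k + p) ≤ 2 * m

μ≤⅔-edges3 : ∀ x → μ≤⅔ (𝟙 (x ≡ᵇ 3)) (𝟙 (x ≡ᵇ 2)) (1 * x)
μ≤⅔-edges3 0                         = z≤n
μ≤⅔-edges3 1                         = z≤n
μ≤⅔-edges3 2                         = s≤s (s≤s (s≤s z≤n))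
μ≤⅔-edges3 3                         = ≤-refl
μ≤⅔-edges3 (suc (suc (suc (suc x)))) = z≤n

μ≤⅔-guarded : ∀ p q r u v x →
  μ≤⅔ (𝟙 (p ∧ q ∧ r ∧ u ∧ v ∧ (x ≡ᵇ 3))) (𝟙 (p ∧ q ∧ r ∧ u ∧ v ∧ (x ≡ᵇ 2)))
      (𝟙 (p ∧ q ∧ r ∧ u ∧ v) * x)
μ≤⅔-guarded true  true  true  true  true  x = μ≤⅔-edges3 x
μ≤⅔-guarded true  true  true  true  false x = z≤n
μ≤⅔-guarded true  true  true  false v     x = z≤n
μ≤⅔-guarded true  true  false u     v     x = z≤n
μ≤⅔-guarded true  false r     u     v     x = z≤n
μ≤⅔-guarded false q     r     u     v     x = z≤n

μ≤⅔-sumF : ∀ {n} {f g h : Fin n → ℕ} → (∀ i → μ≤⅔ (f i) (g i) (h i)) →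
  μ≤⅔ (sumF f) (sumF g) (sumF h)
μ≤⅔-sumF {f = f} {g} {h} f,g≤h = subst₂ _≤_ linear (sumF-* 2 h) (sumF-mono f,g≤h)
  where
  linear : sumF (λ i → 3 * (2 * f i + g i)) ≡ 3 * (2 * sumF f + sumF g)
  linear =
    begin
      sumF (λ i → 3 * (2 * f i + g i))
    ≡⟨ sumF-* 3 (λ i → 2 * f i + g i) ⟩
      3 * sumF (λ i → 2 * f i + g i)
    ≡⟨ cong (3 *_) (sumF-+ (λ i → 2 * f i) g) ⟩
      3 * (sumF (λ i → 2 * f i) + sumF g)
    ≡⟨ cong (λ z → 3 * (z + sumF g)) (sumF-* 2 f) ⟩
      3 * (2 * sumF f + sumF g)
    ∎

μOn≤⅔tripleEdgeSum : ∀ {n} (a : Fin n → Fin n → Bool) (S : Subset n) →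
  3 * μOn a S ≤ 2 * tripleEdgeSum a S
μOn≤⅔tripleEdgeSum a S =
  μ≤⅔-sumF λ i → μ≤⅔-sumF λ j → μ≤⅔-sumF λ k →
    μ≤⅔-guarded (i <F j) (j <F k) (lookup S i) (lookup S j) (lookup S k) (edges3 a i j k)

μOn-bound : ∀ {n} (a : Fin n → Fin n → Bool) (S : Subset n) →
  3 * μOn a S ≤ 2 * (∣ S ∣ ∸ 2) * eOn a S
μOn-bound a S =
  subst (3 * μOn a S ≤_)
    (trans (cong (2 *_) (tripleEdgeSum≡[∣S∣∸2]*e a S)) (sym (*-assoc 2 (∣ S ∣ ∸ 2) (eOn a S))))
    (μOn≤⅔tripleEdgeSum a S)

∣allV∣≡n : ∀ n → ∣ allV {n} ∣ ≡ n
∣allV∣≡n zero    = refl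
∣allV∣≡n (suc n) = cong suc (∣allV∣≡n n)

mainTheorem10 :
    ((n : ℕ) → (G : Graph n) → 3 * μ G ≤ 2 * (n ∸ 2) * e G)
    ×
    ((n r : ℕ) → (G : Graph n) → (T : Subset n) →
      1 ≤ r → MaxDeg≤ G r → Cluster G r T →
      2 * (∣ commonNbhd G T ∣ ∸ 2) ≤ 3 * ∣ T ∣ →
      Foldable G T)
mainTheorem10 = μ-bound , cluster-foldable
  where
  μ-bound : (n : ℕ) → (G : Graph n) → 3 * μ G ≤ 2 * (n ∸ 2) * e G
  μ-bound n G = subst (λ m → 3 * μ G ≤ 2 * (m ∸ 2) * e G) (∣allV∣≡n n) (μOn-bound (adj G) allV)

  cluster-foldable : (n r : ℕ) → (G : Graph n) → (T : Subset n) →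
    1 ≤ r → MaxDeg≤ G r → Cluster G r T →
    2 * (∣ commonNbhd G T ∣ ∸ 2) ≤ 3 * ∣ T ∣ →
    Foldable G T
  cluster-foldable n r G T _ _ _ 2[s∸2]≤3t = *-cancelˡ-≤ 3 (
    ≤-trans (μOn-bound (nonAdj G) S)
      (≤-trans (*-monoˡ-≤ eR 2[s∸2]≤3t) (≤-reflexive (*-assoc 3 ∣ T ∣ eR))))
    where
    S = commonNbhd G T
    eR = eOn (nonAdj G) S
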